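{- For each grid graph $P_m\Box P_n$, the nim-value of the avoidance removing game $\text{DNT}(P_m\Box P_n)$ equals the parity of $mn$, i.e. it is $(mn \bmod 2)$.
   Context: $P_k$ is the path graph on $k$ vertices, and a grid graph is $P_m\Box P_n$ with $2\le m\le n$, $n\ge 3$. A vertex set is (geodetically) convex if it contains every vertex on every shortest path between two of its vertices; the convex hull $[S]$ is the smallest convex set containing $S$. In the removing game $\text{DNT}(\Gamma)$ on a graph $\Gamma$ with vertex set $V$, two players alternately select previously unselected vertices; a position is the set $P$ of selected vertices, and a move is legal only if afterwards the convex hull of the unselected vertices is still all of $V$, i.e. $[V\setminus P]=V$. The last player to move wins (normal play). The nim-value is the Sprague–Grundy value of the starting position. -}

module Defs where

open import Data.Nat using (ℕ; zero; suc; _+_; _<_)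
open import Data.Fin using (Fin; toℕ)
open import Data.Fin.Properties using () renaming (_≟_ to _≟F_)
open import Data.Bool using (Bool; true; false; not; _∨_)
open import Data.Product using (_×_; _,_; Σ; ∃)
open import Data.Sum using (_⊎_)
open import Relation.Nullary using (¬_; yes; no)
open import Relation.Binary.PropositionalEquality using (_≡_; _≢_; refl)
open import Data.List using (List; []; _∷_)
open import Data.List.Relation.Unary.All using (All)

record Graph : Set₁ where
  field
    V   : Set
    Adj : V → V → Set
open Graph public

PathGraph : ℕ → Graph
PathGraph k = record
  { V   = Fin k
  ; Adj = λ i j → (suc (toℕ i) ≡ toℕ j) ⊎ (suc (toℕ j) ≡ toℕ i) }

_□_ : Graph → Graph → Graph
G □ H = record
  { V   = V G × V H
  ; Adj = λ { (g , h) (g' , h') →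
              (g ≡ g' × Adj H h h') ⊎ (Adj G g g' × h ≡ h') } }

Grid : ℕ → ℕ → Graph
Grid m n = PathGraph m □ PathGraph n

module _ (G : Graph) where

  -- A path (walk) from u to v given as its list of vertices after u,
  -- of length (number of edges) k.
  data Walk : V G → V G → ℕ → List (V G) → Set where
    stop : ∀ {u} → Walk u u 0 []
    step : ∀ {u w v k ws} → Adj G u w → Walk w v k ws → Walk u v (suc k) (w ∷ ws)

  IsDist : V G → V G → ℕ → Set
  IsDist u v d = (∃ λ ws → Walk u v d ws) × (∀ k ws → Walk u v k ws → ¬ (k < d))

  ShortestPath : V G → V G → List (V G) → Set
  ShortestPath u v ws = Σ ℕ λ d → Walk u v d ws × IsDist u v d

  VSet : Set
  VSet = V G → Bool

  _∈_ : V G → VSet → Set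
  x ∈ S = S x ≡ true

  Convex : VSet → Set
  Convex C = ∀ u v ws → u ∈ C → v ∈ C → ShortestPath u v ws → All (λ x → x ∈ C) ws

  -- The convex hull [S] is all of V: every convex set containing S is V
  -- (the convex hull is the intersection of all convex supersets).
  HullIsAll : VSet → Set
  HullIsAll S = ∀ (C : VSet) → Convex C → (∀ x → x ∈ S → x ∈ C) → ∀ x → x ∈ C

module DNT (G : Graph) (_≟_ : (x y : V G) → Relation.Nullary.Dec (x ≡ y)) where

  Position : Set
  Position = VSet G

  empty : Position
  empty _ = false

  complement : Position → VSet G
  complement P x = not (P x)

  insert : V G → Position → Position
  insert v P x with x ≟ v
  ... | yes _ = true
  ... | no  _ = P x

  Legal : Position → Set
  Legal P = HullIsAll G (complement P)

  Move : Position → V G → Set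
  Move P v = (P v ≡ false) × Legal (insert v P)

  -- f is the Sprague–Grundy function of the game: on every legal position,
  -- f P is the mex of the values of the options.
  IsGrundy : (Position → ℕ) → Set
  IsGrundy f = ∀ P → Legal P →
      (∀ v → Move P v → f (insert v P) ≢ f P)
    × (∀ j → j < f P → ∃ λ v → Move P v × f (insert v P) ≡ j)

  NimValue : ℕ → Set
  NimValue g = (∃ λ (f : Position → ℕ) → IsGrundy f)
             × (∀ f → IsGrundy f → f empty ≡ g)

gridEq : ∀ {m n} (x y : V (Grid m n)) → Relation.Nullary.Dec (x ≡ y)
gridEq (a , b) (c , d) with a ≟F c | b ≟F d
... | yes refl | yes refl = yes refl
... | no p | _ = no λ { refl → p refl }
... | yes _ | no q = no λ { refl → q refl }

-- A position is legal exactly when each of the four sides of the grid still carries an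
-- unselected vertex. Distances are Manhattan distances, so the complement of a side is convex;
-- conversely, unselected vertices on two adjacent sides put the corner between them into every
-- convex set containing them, and the corners (0,0) and (m-1,n-1) span the whole grid.
-- Hence the half-turn σ of the grid maps sides to opposite sides, and after any legal move v
-- from a σ-symmetric position the reply σ v is legal again. If m or n is even, σ has no fixed
-- point and this mirror strategy shows that every symmetric legal position, the empty one
-- included, has value 0. If both are odd, the centre is the only fixed point and lies on no
-- side: taking it leads to value 0, while mirroring every other move shows that symmetric
-- positions with the centre unselected have value exactly 1.

module Submission where

open import Defs hiding (_∈_)
open import Data.Bool as Bool using (true; false; not; if_then_else_)
open import Data.Bool.Properties using (not-involutive)
open import Data.Fin using (Fin; zero; suc; toℕ; fromℕ<; opposite)
open import Data.Fin.Properties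
  using (toℕ-injective; toℕ<n; toℕ-fromℕ<; toℕ-fromℕ; opposite-prop; opposite-involutive; any?)
open import Data.List using (List; []; _∷_; _++_; map; filter; allFin; cartesianProduct)
open import Data.List.Membership.Propositional using (_∈_; _∉_)
open import Data.List.Membership.Propositional.Properties
  using (∈-++⁺ˡ; ∈-map⁺; ∈-map⁻; ∈-filter⁺; ∈-filter⁻; ∈-cartesianProduct⁺; ∈-allFin)
open import Data.List.Relation.Unary.All as All using (All; []; _∷_)
open import Data.List.Relation.Unary.AllPairs using (_∷_)
open import Data.List.Relation.Unary.Any using (here; there)
open import Data.List.Relation.Unary.Unique.Propositional using (Unique)
open import Data.List.Relation.Unary.Unique.Propositional.Properties using (allFin⁺; cartesianProduct⁺)
open import Data.Nat
open import Data.Nat.DivMod using (m%n<n; %-distribˡ-*; [m+kn]%n≡m%n; m≡m%n+[m/n]*n)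
open import Data.Nat.ListAction using (sum)
open import Data.Nat.Induction using (<-wellFounded)
open import Data.Nat.Properties
open import Algebra.Properties.CommutativeSemigroup +-commutativeSemigroup using (interchange)
open import Data.Product using (_×_; _,_; ∃; ∃₂; proj₁; proj₂)
open import Data.Sum as Sum using (_⊎_; inj₁; inj₂)
open import Function using (_∘_)
open import Induction.WellFounded using (WellFounded; Acc; acc)
open import Relation.Binary.Construct.On as On using ()
open import Relation.Binary.Definitions using (DecidableEquality)
open import Relation.Binary.PropositionalEquality
open import Data.List.Membership.DecPropositional _≟_ using (_∈?_)
open import Relation.Nullary using (¬_; Dec; yes; no; does; contradiction; map′; _×-dec_)

∣n-1+n∣≡1 : ∀ n → ∣ n - suc n ∣ ≡ 1
∣n-1+n∣≡1 zero    = refl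
∣n-1+n∣≡1 (suc n) = ∣n-1+n∣≡1 n

∣-∣-between : ∀ {m n o} → m ≤ n → n ≤ o → ∣ m - n ∣ + ∣ n - o ∣ ≡ ∣ m - o ∣
∣-∣-between {n = n} z≤n n≤o = trans (cong (n +_) (m≤n⇒∣m-n∣≡n∸m n≤o)) (m+[n∸m]≡n n≤o)
∣-∣-between (s≤s m≤n) (s≤s n≤o) = ∣-∣-between m≤n n≤o

∣-∣-detour-below : ∀ {m n o} → o < m → o < n → ∣ m - n ∣ < ∣ m - o ∣ + ∣ o - n ∣
∣-∣-detour-below {suc m} {suc n} {zero} _ _ =
  s≤s (≤-trans (∣m-n∣≤m⊔n m n) (≤-trans (m⊔n≤m+n m n) (+-monoʳ-≤ m (n≤1+n n))))
∣-∣-detour-below {suc m} {suc n} {suc o} (s≤s o<m) (s≤s o<n) = ∣-∣-detour-below o<m o<n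

∣-∣-detour-above : ∀ {m n o} → m < o → n < o → ∣ m - n ∣ < ∣ m - o ∣ + ∣ o - n ∣
∣-∣-detour-above {zero}  {zero}  {suc o} _ _ = s≤s z≤n
∣-∣-detour-above {zero}  {suc n} {suc o} _ (s≤s n<o) = s≤s (≤-trans n<o (m≤m+n o _))
∣-∣-detour-above {suc m} {zero}  {suc o} (s≤s m<o) _ =
  ≤-trans (s≤s (≤-trans m<o (m≤n+m o _))) (≤-reflexive (sym (+-suc _ o)))
∣-∣-detour-above {suc m} {suc n} {suc o} (s≤s m<o) (s≤s n<o) = ∣-∣-detour-above m<o n<o

%2≡0⊎%2≡1 : ∀ n → n % 2 ≡ 0 ⊎ n % 2 ≡ 1
%2≡0⊎%2≡1 n with n % 2 | m%n<n n 2
... | 0           | _ = inj₁ refl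
... | 1           | _ = inj₂ refl
... | suc (suc _) | s≤s (s≤s ())

[m*n]%2≡[m%2]*[n%2] : ∀ m n → (m * n) % 2 ≡ (m % 2) * (n % 2)
[m*n]%2≡[m%2]*[n%2] m n with %-distribˡ-* m n 2 | %2≡0⊎%2≡1 m | %2≡0⊎%2≡1 n
... | eq | inj₁ m-even | _           rewrite m-even = eq
... | eq | inj₂ m-odd  | inj₁ n-even rewrite m-odd | n-even = eq
... | eq | inj₂ m-odd  | inj₂ n-odd  rewrite m-odd | n-odd = eq

-- Minimum excludant

∈⇒≤sum : ∀ {x xs} → x ∈ xs → x ≤ sum xs
∈⇒≤sum {xs = y ∷ ys} (here refl) = m≤m+n y (sum ys)
∈⇒≤sum {xs = y ∷ ys} (there x∈ys) = ≤-trans (∈⇒≤sum x∈ys) (m≤n+m (sum ys) y)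

IsMex : List ℕ → ℕ → Set
IsMex xs k = k ∉ xs × (∀ {j} → j < k → j ∈ xs)

mex-search : ∀ xs b → (∀ {j} → j < b → j ∈ xs) ⊎ ∃ (IsMex xs)
mex-search xs zero = inj₁ λ ()
mex-search xs (suc b) with mex-search xs b
... | inj₂ found = inj₂ found
... | inj₁ below with b ∈? xs
...   | no  b∉xs = inj₂ (b , b∉xs , below)
...   | yes b∈xs = inj₁ extend
  where
  extend : ∀ {j} → j < suc b → j ∈ xs
  extend j<1+b with m≤n⇒m<n∨m≡n (s≤s⁻¹ j<1+b)
  ... | inj₁ j<b  = below j<b
  ... | inj₂ refl = b∈xs

mex-exists : ∀ xs → ∃ (IsMex xs)
mex-exists xs with mex-search xs (2 + sum xs)
... | inj₁ all-below = contradiction (∈⇒≤sum (all-below ≤-refl)) (n≮n (sum xs))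
... | inj₂ found     = found

mex : List ℕ → ℕ
mex xs = proj₁ (mex-exists xs)

mex∉ : ∀ xs → mex xs ∉ xs
mex∉ xs = proj₁ (proj₂ (mex-exists xs))

mex-minimal : ∀ xs {j} → j < mex xs → j ∈ xs
mex-minimal xs = proj₂ (proj₂ (mex-exists xs))

-- Walks and geodesic convexity

module _ {G : Graph} where

  _++ʷ_ : ∀ {u w v k l ws vs} → Walk G u w k ws → Walk G w v l vs → Walk G u v (k + l) (ws ++ vs)
  stop     ++ʷ q = q
  step a p ++ʷ q = step a (p ++ʷ q)

  walk-target : ∀ {u v k ws} → Walk G u v k ws → u ≡ v ⊎ v ∈ ws
  walk-target stop = inj₁ refl
  walk-target (step _ p) with walk-target p
  ... | inj₁ refl = inj₂ (here refl)
  ... | inj₂ v∈ws = inj₂ (there v∈ws)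

  walk-split : ∀ {u v k ws x} → Walk G u v k ws → x ∈ ws →
               ∃₂ λ i j → i + j ≡ k × (∃ λ ws₁ → Walk G u x i ws₁) × (∃ λ ws₂ → Walk G x v j ws₂)
  walk-split (step a p) (here refl) = 1 , _ , refl , (_ , step a stop) , (_ , p)
  walk-split (step a p) (there x∈ws) with walk-split p x∈ws
  ... | i , j , i+j≡k , (_ , p₁) , p₂ = suc i , j , cong suc i+j≡k , (_ , step a p₁) , p₂

walk-map : ∀ {G H : Graph} (f : V G → V H) → (∀ {x y} → Adj G x y → Adj H (f x) (f y)) →
           ∀ {u v k ws} → Walk G u v k ws → Walk H (f u) (f v) k (map f ws)
walk-map f f-adj stop       = stop
walk-map f f-adj (step a p) = step (f-adj a) (walk-map f f-adj p)

module Geodesic (G : Graph) (d : V G → V G → ℕ) (d-isDist : ∀ u v → IsDist G u v (d u v)) where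

  d-≤-walk : ∀ {u v k ws} → Walk G u v k ws → d u v ≤ k
  d-≤-walk {u} {v} p = ≮⇒≥ (proj₂ (d-isDist u v) _ _ p)

  geodesic⊆convex : ∀ {C u v} x → Convex G C → C u ≡ true → C v ≡ true →
                    d u x + d x v ≡ d u v → C x ≡ true
  geodesic⊆convex {C} {u} {v} x C-convex Cu Cv on-geodesic
    with proj₁ (d-isDist u x) | proj₁ (d-isDist x v)
  ... | ws₁ , p₁ | ws₂ , p₂ with walk-target p₁
  ...   | inj₁ refl  = Cu
  ...   | inj₂ x∈ws₁ = All.lookup (C-convex u v _ Cu Cv (d u v , path , d-isDist u v)) (∈-++⁺ˡ x∈ws₁)
    where
    path : Walk G u v (d u v) (ws₁ ++ ws₂)
    path = subst (λ k → Walk G u v k (ws₁ ++ ws₂)) on-geodesic (p₁ ++ʷ p₂)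

  detours-longer⇒convex : ∀ {C} →
    (∀ u v w → C u ≡ true → C v ≡ true → C w ≡ false → d u v < d u w + d w v) → Convex G C
  detours-longer⇒convex {C} longer u v ws Cu Cv (k , p , k-isDist) = All.tabulate on-path
    where
    k≤d : k ≤ d u v
    k≤d = ≮⇒≥ (proj₂ k-isDist (d u v) _ (proj₂ (proj₁ (d-isDist u v))))
    on-path : ∀ {w} → w ∈ ws → C w ≡ true
    on-path {w} w∈ws with C w in Cw | walk-split p w∈ws
    ... | true  | _ = refl
    ... | false | i , j , i+j≡k , (_ , p₁) , (_ , p₂) =
      contradiction (longer u v w Cu Cv Cw)
        (≤⇒≯ (≤-trans (+-mono-≤ (d-≤-walk p₁) (d-≤-walk p₂)) (≤-trans (≤-reflexive i+j≡k) k≤d)))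

-- Grundy values and the mirror strategy

module DNT-Properties (G : Graph) (_≟_ : DecidableEquality (V G)) where

  open DNT G _≟_

  insert-≡ : ∀ v P → insert v P v ≡ true
  insert-≡ v P with v ≟ v
  ... | yes _   = refl
  ... | no v≢v = contradiction refl v≢v

  insert-≢ : ∀ {v x} P → x ≢ v → insert v P x ≡ P x
  insert-≢ {v} {x} P x≢v with x ≟ v
  ... | yes x≡v = contradiction x≡v x≢v
  ... | no _    = refl

  insert-true : ∀ {v x} P → P x ≡ true → insert v P x ≡ true
  insert-true {v} {x} P Px with x ≟ v
  ... | yes _ = refl
  ... | no _  = Px

  module Finite (vertices : List (V G)) (∈-vertices : ∀ v → v ∈ vertices)
                (vertices-unique : Unique vertices) where

    unselectedIn : List (V G) → Position → ℕ
    unselectedIn []       P = 0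
    unselectedIn (x ∷ xs) P = (if P x then 0 else 1) + unselectedIn xs P

    unselected : Position → ℕ
    unselected = unselectedIn vertices

    unselectedIn-insert-∉ : ∀ {v} xs P → All (v ≢_) xs → unselectedIn xs (insert v P) ≡ unselectedIn xs P
    unselectedIn-insert-∉ []       P []           = refl
    unselectedIn-insert-∉ (x ∷ xs) P (v≢x ∷ v∉xs) rewrite insert-≢ P (v≢x ∘ sym) =
      cong (_ +_) (unselectedIn-insert-∉ xs P v∉xs)

    unselectedIn-insert : ∀ {v} xs P → Unique xs → v ∈ xs → P v ≡ false →
                          suc (unselectedIn xs (insert v P)) ≡ unselectedIn xs P
    unselectedIn-insert (x ∷ xs) P (x∉xs ∷ _) (here refl) Px≡false rewrite insert-≡ x P | Px≡false =
      cong suc (unselectedIn-insert-∉ xs P x∉xs)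
    unselectedIn-insert (x ∷ xs) P (x∉xs ∷ xs-unique) (there v∈xs) Pv≡false
      rewrite insert-≢ P (All.lookup x∉xs v∈xs) =
      trans (sym (+-suc _ _)) (cong (_ +_) (unselectedIn-insert xs P xs-unique v∈xs Pv≡false))

    move-decreases : ∀ {P v} → Move P v → suc (unselected (insert v P)) ≡ unselected P
    move-decreases {P} {v} mv = unselectedIn-insert vertices P vertices-unique (∈-vertices v) (proj₁ mv)

    module _ (move? : ∀ P v → Dec (Move P v)) where

      options : Position → List (V G)
      options P = filter (move? P) vertices

      -- Fuel: grundyWithin k P is the Grundy value of P when k = unselected P.
      grundyWithin : ℕ → Position → ℕ
      grundyWithin zero    P = 0
      grundyWithin (suc k) P = mex (map (λ v → grundyWithin k (insert v P)) (options P))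

      grundy : Position → ℕ
      grundy P = grundyWithin (unselected P) P

      grundy-isGrundy : IsGrundy grundy
      grundy-isGrundy P _ with unselected P in eq
      ... | zero  = (λ v mv _ → 0≢1+n (sym (trans (move-decreases mv) eq))) , λ j ()
      ... | suc k = excluded , attained
        where
        values : List ℕ
        values = map (λ v → grundyWithin k (insert v P)) (options P)
        after : ∀ {v} → Move P v → grundy (insert v P) ≡ grundyWithin k (insert v P)
        after mv = cong (λ t → grundyWithin t _) (suc-injective (trans (move-decreases mv) eq))
        excluded : ∀ v → Move P v → grundy (insert v P) ≢ mex values
        excluded v mv same = mex∉ values (subst (_∈ values) (trans (sym (after mv)) same)
                                                (∈-map⁺ _ (∈-filter⁺ (move? P) (∈-vertices v) mv)))
        attained : ∀ j → j < mex values → ∃ λ v → Move P v × grundy (insert v P) ≡ j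
        attained j j<mex with ∈-map⁻ _ (mex-minimal values j<mex)
        ... | v , v∈options , j≡ = v , mv , trans (after mv) (sym j≡)
          where
          mv : Move P v
          mv = proj₂ (∈-filter⁻ (move? P) {xs = vertices} v∈options)

  module Symmetry (σ : V G → V G) (σ-involutive : ∀ x → σ (σ x) ≡ x) where

    Symmetric : Position → Set
    Symmetric P = ∀ x → P (σ x) ≡ P x

    FixedSelected : Position → Set
    FixedSelected P = ∀ x → σ x ≡ x → P x ≡ true

    σ-injective : ∀ {x y} → σ x ≡ σ y → x ≡ y
    σ-injective {x} {y} σx≡σy = trans (sym (σ-involutive x)) (trans (cong σ σx≡σy) (σ-involutive y))

    insert-pair-symmetric : ∀ {P} v → Symmetric P → Symmetric (insert (σ v) (insert v P))
    insert-pair-symmetric {P} v P-sym x = by-cases (x ≟ v) (x ≟ σ v)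
      where
      open ≡-Reasoning
      Q : Position
      Q = insert (σ v) (insert v P)
      by-cases : Dec (x ≡ v) → Dec (x ≡ σ v) → Q (σ x) ≡ Q x
      by-cases (yes refl) _ = trans (insert-≡ (σ x) _) (sym (insert-true _ (insert-≡ x P)))
      by-cases (no _) (yes refl) =
        trans (cong Q (σ-involutive v)) (trans (insert-true _ (insert-≡ v P)) (sym (insert-≡ (σ v) _)))
      by-cases (no x≢v) (no x≢σv) = begin
        Q (σ x)          ≡⟨ insert-≢ _ (x≢v ∘ σ-injective) ⟩
        insert v P (σ x) ≡⟨ insert-≢ P (λ σx≡v → x≢σv (trans (sym (σ-involutive x)) (cong σ σx≡v))) ⟩
        P (σ x)          ≡⟨ P-sym x ⟩
        P x              ≡⟨ insert-≢ P x≢v ⟨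
        insert v P x     ≡⟨ insert-≢ _ x≢σv ⟨
        Q x              ∎

    insert-fixed-symmetric : ∀ {P c} → σ c ≡ c → Symmetric P → Symmetric (insert c P)
    insert-fixed-symmetric {P} {c} σc≡c P-sym x = by-cases (x ≟ c)
      where
      by-cases : Dec (x ≡ c) → insert c P (σ x) ≡ insert c P x
      by-cases (yes refl) = cong (insert x P) σc≡c
      by-cases (no x≢c)   = begin
        insert c P (σ x) ≡⟨ insert-≢ P (λ σx≡c → x≢c (σ-injective (trans σx≡c (sym σc≡c)))) ⟩
        P (σ x)          ≡⟨ P-sym x ⟩
        P x              ≡⟨ insert-≢ P x≢c ⟨
        insert c P x     ∎
        where open ≡-Reasoning

    module Strategy (size : Position → ℕ)
                    (move-shrinks : ∀ {P v} → Move P v → size (insert v P) < size P)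
                    (mirror-move : ∀ {P v} → Symmetric P → Move P v → σ v ≢ v → Move (insert v P) (σ v))
                    {f : Position → ℕ} (f-isGrundy : IsGrundy f) where

      _⊏_ : Position → Position → Set
      Q ⊏ P = size Q < size P

      ⊏-wellFounded : WellFounded _⊏_
      ⊏-wellFounded = On.wellFounded size <-wellFounded

      reply-⊏ : ∀ {P v w} → Move P v → Move (insert v P) w → insert w (insert v P) ⊏ P
      reply-⊏ mv mw = <-trans (move-shrinks mw) (move-shrinks mv)

      fixed-selected⇒value-zero : ∀ P → Acc _⊏_ P → Legal P → Symmetric P → FixedSelected P → f P ≡ 0
      fixed-selected⇒value-zero P (acc rec) P-legal P-sym P-fixed with f P in fP
      ... | zero  = refl
      ... | suc _ with proj₂ (f-isGrundy P P-legal) 0 (subst (0 <_) (sym fP) z<s)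
      ...   | v , mv , f[P+v]≡0 =
        contradiction (trans f[Q]≡0 (sym f[P+v]≡0)) (proj₁ (f-isGrundy _ (proj₂ mv)) (σ v) reply)
        where
        σv≢v : σ v ≢ v
        σv≢v σv≡v = contradiction (trans (sym (proj₁ mv)) (P-fixed v σv≡v)) λ ()
        reply : Move (insert v P) (σ v)
        reply = mirror-move P-sym mv σv≢v
        f[Q]≡0 : f (insert (σ v) (insert v P)) ≡ 0
        f[Q]≡0 = fixed-selected⇒value-zero _ (rec (reply-⊏ mv reply)) (proj₂ reply)
                   (insert-pair-symmetric v P-sym)
                   (λ x σx≡x → insert-true _ (insert-true P (P-fixed x σx≡x)))

      module Centre (c : V G) (σc≡c : σ c ≡ c) (fixed⇒c : ∀ x → σ x ≡ x → x ≡ c)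
                    (centre-move : ∀ {P} → Legal P → P c ≡ false → Move P c) where

        value-after-centre≡0 : ∀ {P} → Legal P → Symmetric P → P c ≡ false → f (insert c P) ≡ 0
        value-after-centre≡0 {P} P-legal P-sym Pc≡false =
          fixed-selected⇒value-zero _ (⊏-wellFounded _) (proj₂ (centre-move P-legal Pc≡false))
            (insert-fixed-symmetric σc≡c P-sym)
            (λ x σx≡x → subst (λ y → insert c P y ≡ true) (sym (fixed⇒c x σx≡x)) (insert-≡ c P))

        centre-unselected⇒value-one : ∀ P → Acc _⊏_ P → Legal P → Symmetric P → P c ≡ false → f P ≡ 1
        centre-unselected⇒value-one P (acc rec) P-legal P-sym Pc≡false with f P in fP
        ... | zero = contradiction (trans (value-after-centre≡0 P-legal P-sym Pc≡false) (sym fP))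
                       (proj₁ (f-isGrundy P P-legal) c (centre-move P-legal Pc≡false))
        ... | suc zero = refl
        ... | suc (suc _) with proj₂ (f-isGrundy P P-legal) 1 (subst (1 <_) (sym fP) (s<s z<s))
        ...   | v , mv , f[P+v]≡1 =
          contradiction (trans f[Q]≡1 (sym f[P+v]≡1)) (proj₁ (f-isGrundy _ (proj₂ mv)) (σ v) reply)
          where
          v≢c : v ≢ c
          v≢c v≡c = 0≢1+n (trans (sym (value-after-centre≡0 P-legal P-sym Pc≡false))
                                  (subst (λ y → f (insert y P) ≡ 1) v≡c f[P+v]≡1))
          reply : Move (insert v P) (σ v)
          reply = mirror-move P-sym mv (v≢c ∘ fixed⇒c v)
          c≢σv : c ≢ σ v
          c≢σv c≡σv = v≢c (trans (sym (trans (cong σ c≡σv) (σ-involutive v))) σc≡c)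
          f[Q]≡1 : f (insert (σ v) (insert v P)) ≡ 1
          f[Q]≡1 = centre-unselected⇒value-one _ (rec (reply-⊏ mv reply)) (proj₂ reply)
                     (insert-pair-symmetric v P-sym)
                     (trans (insert-≢ _ c≢σv) (trans (insert-≢ P (v≢c ∘ sym)) Pc≡false))

-- Geometry of the grid

path-adjacent⇒∣-∣≡1 : ∀ {k} {i j : Fin k} → Adj (PathGraph k) i j → ∣ toℕ i - toℕ j ∣ ≡ 1
path-adjacent⇒∣-∣≡1 {i = i} (inj₁ i+1≡j) rewrite sym i+1≡j = ∣n-1+n∣≡1 (toℕ i)
path-adjacent⇒∣-∣≡1 {j = j} (inj₂ j+1≡i) rewrite sym j+1≡i =
  trans (∣-∣-comm (suc (toℕ j)) (toℕ j)) (∣n-1+n∣≡1 (toℕ j))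

walk-suc : ∀ {k} {i j : Fin k} {l ws} → Walk (PathGraph k) i j l ws →
           Walk (PathGraph (suc k)) (suc i) (suc j) l (map suc ws)
walk-suc = walk-map suc (Sum.map (cong suc) (cong suc))

path-walk : ∀ {k} (i j : Fin k) → ∃ λ ws → Walk (PathGraph k) i j ∣ toℕ i - toℕ j ∣ ws
path-walk zero    zero    = _ , stop
path-walk (suc i) (suc j) = _ , walk-suc (proj₂ (path-walk i j))
path-walk {suc (suc k)} zero (suc j) = _ , step (inj₁ refl) (walk-suc (proj₂ (path-walk zero j)))
path-walk {suc (suc k)} (suc i) zero with path-walk i zero
... | ws , p =
  _ , subst (λ l → Walk (PathGraph _) (suc i) zero l (map suc ws ++ zero ∷ []))
            (trans (+-comm _ 1) (cong suc (∣-∣-identityʳ (toℕ i))))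
            (walk-suc p ++ʷ step (inj₂ refl) stop)

opposite-first : ∀ {k} {i : Fin k} → toℕ i ≡ 0 → suc (toℕ (opposite i)) ≡ k
opposite-first {suc k} {zero} _ = cong suc (toℕ-fromℕ k)

opposite-last : ∀ {k} {i : Fin k} → suc (toℕ i) ≡ k → toℕ (opposite i) ≡ 0
opposite-last {k} {i} last = trans (opposite-prop i) (trans (cong (k ∸_) last) (n∸n≡0 k))

first≢last : ∀ {k} {i : Fin k} → 2 ≤ k → toℕ i ≡ 0 → suc (toℕ i) ≢ k
first≢last 2≤k first last = n≮n 1 (subst (1 <_) (trans (sym last) (cong suc first)) 2≤k)

≤-last : ∀ {k} {i : Fin k} (i′ : Fin k) → suc (toℕ i) ≡ k → toℕ i′ ≤ toℕ i
≤-last i′ last = s≤s⁻¹ (subst (toℕ i′ <_) (sym last) (toℕ<n i′))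

first<nonfirst : ∀ {k} {i i′ : Fin k} → toℕ i ≡ 0 → toℕ i′ ≢ 0 → toℕ i < toℕ i′
first<nonfirst first nonfirst = subst (_< _) (sym first) (n≢0⇒n>0 nonfirst)

nonlast<last : ∀ {k} {i i′ : Fin k} → suc (toℕ i) ≡ k → suc (toℕ i′) ≢ k → toℕ i′ < toℕ i
nonlast<last {i′ = i′} last nonlast =
  ≤∧≢⇒< (≤-last i′ last) (λ same → nonlast (trans (cong suc same) last))

m*2≡m+m : ∀ m → m * 2 ≡ m + m
m*2≡m+m m = trans (*-suc m 1) (cong (m +_) (*-identityʳ m))

opposite-fixed⇒odd : ∀ {k} {i : Fin k} → opposite i ≡ i → k ≡ 1 + toℕ i * 2
opposite-fixed⇒odd {k} {i} fixed = begin
  k                     ≡⟨ m∸n+n≡m (toℕ<n i) ⟨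
  k ∸ suc t + suc t     ≡⟨ cong (_+ suc t) (trans (sym (opposite-prop i)) (cong toℕ fixed)) ⟩
  t + suc t             ≡⟨ +-suc t t ⟩
  suc (t + t)           ≡⟨ cong suc (m*2≡m+m t) ⟨
  1 + t * 2             ∎
  where
  open ≡-Reasoning
  t : ℕ
  t = toℕ i

even⇒no-opposite-fixed : ∀ {k} → k % 2 ≡ 0 → (i : Fin k) → opposite i ≢ i
even⇒no-opposite-fixed even i fixed =
  0≢1+n (trans (sym even) (trans (cong (_% 2) (opposite-fixed⇒odd fixed)) ([m+kn]%n≡m%n 1 (toℕ i) 2)))

opposite-fixed-unique : ∀ {k} {i j : Fin k} → opposite i ≡ i → opposite j ≡ j → i ≡ j
opposite-fixed-unique i-fixed j-fixed =
  toℕ-injective (*-cancelʳ-≡ _ _ 2 (suc-injective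
    (trans (sym (opposite-fixed⇒odd i-fixed)) (opposite-fixed⇒odd j-fixed))))

odd⇒opposite-fixed : ∀ {k} → k % 2 ≡ 1 → ∃ λ (i : Fin k) → opposite i ≡ i
odd⇒opposite-fixed {k} odd = i , toℕ-injective (begin
  toℕ (opposite i)  ≡⟨ opposite-prop i ⟩
  k ∸ suc (toℕ i)   ≡⟨ cong₂ (λ a b → a ∸ suc b) k≡1+h*2 (toℕ-fromℕ< h<k) ⟩
  h * 2 ∸ h         ≡⟨ cong (_∸ h) (m*2≡m+m h) ⟩
  h + h ∸ h         ≡⟨ m+n∸m≡n h h ⟩
  h                 ≡⟨ toℕ-fromℕ< h<k ⟨
  toℕ i             ∎)
  where
  open ≡-Reasoning
  h : ℕ
  h = k / 2
  k≡1+h*2 : k ≡ 1 + h * 2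
  k≡1+h*2 = trans (m≡m%n+[m/n]*n k 2) (cong (_+ h * 2) odd)
  h<k : h < k
  h<k = subst (h <_) (sym k≡1+h*2) (s≤s (m≤m*n h 2))
  i : Fin k
  i = fromℕ< h<k

data Side : Set where
  top bottom left right : Side

opposite-side : Side → Side
opposite-side top    = bottom
opposite-side bottom = top
opposite-side left   = right
opposite-side right  = left

module _ {m n : ℕ} where

  manhattan : Fin m × Fin n → Fin m × Fin n → ℕ
  manhattan (i , j) (i′ , j′) = ∣ toℕ i - toℕ i′ ∣ + ∣ toℕ j - toℕ j′ ∣

  manhattan-self : ∀ u → manhattan u u ≡ 0
  manhattan-self (i , j) rewrite ∣n-n∣≡0 (toℕ i) | ∣n-n∣≡0 (toℕ j) = refl

  row col : Fin m × Fin n → ℕ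
  row = toℕ ∘ proj₁
  col = toℕ ∘ proj₂

  manhattan-via : ∀ u w v →
    manhattan u w + manhattan w v ≡
    (∣ row u - row w ∣ + ∣ row w - row v ∣) + (∣ col u - col w ∣ + ∣ col w - col v ∣)
  manhattan-via u w v =
    interchange ∣ row u - row w ∣ ∣ col u - col w ∣ ∣ row w - row v ∣ ∣ col w - col v ∣

  manhattan-triangle : ∀ u w v → manhattan u v ≤ manhattan u w + manhattan w v
  manhattan-triangle u w v =
    ≤-trans (+-mono-≤ (∣-∣-triangle (row u) (row w) (row v)) (∣-∣-triangle (col u) (col w) (col v)))
            (≤-reflexive (sym (manhattan-via u w v)))

  adjacent⇒manhattan≡1 : ∀ {u w} → Adj (Grid m n) u w → manhattan u w ≡ 1
  adjacent⇒manhattan≡1 {i , _} (inj₁ (refl , a)) rewrite ∣n-n∣≡0 (toℕ i) = path-adjacent⇒∣-∣≡1 a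
  adjacent⇒manhattan≡1 {_ , j} (inj₂ (a , refl)) rewrite ∣n-n∣≡0 (toℕ j) | path-adjacent⇒∣-∣≡1 a = refl

  manhattan-≤-walk : ∀ {u v k ws} → Walk (Grid m n) u v k ws → manhattan u v ≤ k
  manhattan-≤-walk {u} stop = ≤-reflexive (manhattan-self u)
  manhattan-≤-walk {u} {v} {suc k} (step {w = w} a p) = begin
    manhattan u v                 ≤⟨ manhattan-triangle u w v ⟩
    manhattan u w + manhattan w v ≡⟨ cong (_+ manhattan w v) (adjacent⇒manhattan≡1 a) ⟩
    suc (manhattan w v)           ≤⟨ s≤s (manhattan-≤-walk p) ⟩
    suc k                         ∎
    where open ≤-Reasoning

  manhattan-walk : ∀ u v → ∃ λ ws → Walk (Grid m n) u v (manhattan u v) ws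
  manhattan-walk (i , j) (i′ , j′) =
    _ , walk-map (_, j) (λ a → inj₂ (a , refl)) (proj₂ (path-walk i i′))
        ++ʷ walk-map (i′ ,_) (λ a → inj₁ (refl , a)) (proj₂ (path-walk j j′))

  manhattan-isDist : ∀ u v → IsDist (Grid m n) u v (manhattan u v)
  manhattan-isDist u v = manhattan-walk u v , λ _ _ p → ≤⇒≯ (manhattan-≤-walk p)

  manhattan-corner : ∀ u v →
    manhattan u (proj₁ u , proj₂ v) + manhattan (proj₁ u , proj₂ v) v ≡ manhattan u v
  manhattan-corner (i , j) (i′ , j′)
    rewrite ∣n-n∣≡0 (toℕ i) | ∣n-n∣≡0 (toℕ j′) | +-identityʳ ∣ toℕ i - toℕ i′ ∣ =
    +-comm ∣ toℕ j - toℕ j′ ∣ ∣ toℕ i - toℕ i′ ∣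

  manhattan-box : ∀ {z x z′} → row z ≤ row x → row x ≤ row z′ → col z ≤ col x → col x ≤ col z′ →
                  manhattan z x + manhattan x z′ ≡ manhattan z z′
  manhattan-box {z} {x} {z′} r≤ ≤r c≤ ≤c =
    trans (manhattan-via z x z′) (cong₂ _+_ (∣-∣-between r≤ ≤r) (∣-∣-between c≤ ≤c))

  row-detour : ∀ u v w → ∣ row u - row v ∣ < ∣ row u - row w ∣ + ∣ row w - row v ∣ →
               manhattan u v < manhattan u w + manhattan w v
  row-detour u v w longer =
    <-≤-trans (+-mono-<-≤ longer (∣-∣-triangle (col u) (col w) (col v)))
              (≤-reflexive (sym (manhattan-via u w v)))

  column-detour : ∀ u v w → ∣ col u - col v ∣ < ∣ col u - col w ∣ + ∣ col w - col v ∣ →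
                  manhattan u v < manhattan u w + manhattan w v
  column-detour u v w longer =
    <-≤-trans (+-mono-≤-< (∣-∣-triangle (row u) (row w) (row v)) longer)
              (≤-reflexive (sym (manhattan-via u w v)))

  OnSide : Side → Fin m × Fin n → Set
  OnSide top    (i , _) = toℕ i ≡ 0
  OnSide bottom (i , _) = suc (toℕ i) ≡ m
  OnSide left   (_ , j) = toℕ j ≡ 0
  OnSide right  (_ , j) = suc (toℕ j) ≡ n

  onSide? : ∀ s x → Dec (OnSide s x)
  onSide? top    (i , _) = toℕ i ≟ 0
  onSide? bottom (i , _) = suc (toℕ i) ≟ m
  onSide? left   (_ , j) = toℕ j ≟ 0
  onSide? right  (_ , j) = suc (toℕ j) ≟ n

  side-detour : ∀ s {u v w} → OnSide s w → ¬ OnSide s u → ¬ OnSide s v →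
                manhattan u v < manhattan u w + manhattan w v
  side-detour top {u} {v} {w} w-on u-off v-off = row-detour u v w
    (∣-∣-detour-below (first<nonfirst {i = proj₁ w} w-on u-off)
                      (first<nonfirst {i = proj₁ w} w-on v-off))
  side-detour bottom {u} {v} {w} w-on u-off v-off = row-detour u v w
    (∣-∣-detour-above (nonlast<last {i′ = proj₁ u} w-on u-off)
                      (nonlast<last {i′ = proj₁ v} w-on v-off))
  side-detour left {u} {v} {w} w-on u-off v-off = column-detour u v w
    (∣-∣-detour-below (first<nonfirst {i = proj₂ w} w-on u-off)
                      (first<nonfirst {i = proj₂ w} w-on v-off))
  side-detour right {u} {v} {w} w-on u-off v-off = column-detour u v w
    (∣-∣-detour-above (nonlast<last {i′ = proj₂ u} w-on u-off)
                      (nonlast<last {i′ = proj₂ v} w-on v-off))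

  reflect : Fin m × Fin n → Fin m × Fin n
  reflect (i , j) = opposite i , opposite j

  reflect-involutive : ∀ x → reflect (reflect x) ≡ x
  reflect-involutive (i , j) = cong₂ _,_ (opposite-involutive i) (opposite-involutive j)

  reflect-side : ∀ s {x} → OnSide s x → OnSide (opposite-side s) (reflect x)
  reflect-side top    = opposite-first
  reflect-side bottom = opposite-last
  reflect-side left   = opposite-first
  reflect-side right  = opposite-last

  reflect-side⁻¹ : ∀ s {x} → OnSide (opposite-side s) x → OnSide s (reflect x)
  reflect-side⁻¹ top    = opposite-last
  reflect-side⁻¹ bottom = opposite-first
  reflect-side⁻¹ left   = opposite-last
  reflect-side⁻¹ right  = opposite-first

-- The game on the grid

module GridGame (m n : ℕ) (2≤m : 2 ≤ m) (2≤n : 2 ≤ n) where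

  open DNT (Grid m n) gridEq
  open DNT-Properties (Grid m n) gridEq
  open Geodesic (Grid m n) manhattan manhattan-isDist

  Vertex : Set
  Vertex = Fin m × Fin n

  sides-disjoint : ∀ s {x : Vertex} → OnSide s x → ¬ OnSide (opposite-side s) x
  sides-disjoint top    first last = first≢last 2≤m first last
  sides-disjoint bottom last first = first≢last 2≤m first last
  sides-disjoint left   first last = first≢last 2≤n first last
  sides-disjoint right  last first = first≢last 2≤n first last

  corner : Vertex
  corner = fromℕ< (<-trans z<s 2≤m) , fromℕ< (<-trans z<s 2≤n)

  side-vertex : ∀ s → ∃ (OnSide {m} {n} s)
  side-vertex top    = corner , toℕ-fromℕ< _
  side-vertex left   = corner , toℕ-fromℕ< _
  side-vertex bottom = reflect corner , reflect-side top {corner} (toℕ-fromℕ< _)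
  side-vertex right  = reflect corner , reflect-side left {corner} (toℕ-fromℕ< _)

  Free : Position → Side → Set
  Free P s = ∃ λ x → P x ≡ false × OnSide s x

  free⇒legal : ∀ {P} → (∀ s → Free P s) → Legal P
  free⇒legal {P} free C C-convex unselected⊆C x
    with free top | free left | free bottom | free right
  ... | t , Pt , t-top | l , Pl , l-left | b , Pb , b-bottom | r , Pr , r-right =
    geodesic⊆convex x C-convex (corner∈C Pt Pl) (corner∈C Pb Pr)
      (manhattan-box (subst (_≤ row x) (sym t-top) z≤n) (≤-last (proj₁ x) b-bottom)
                     (subst (_≤ col x) (sym l-left) z≤n) (≤-last (proj₂ x) r-right))
    where
    unselected∈C : ∀ {y} → P y ≡ false → C y ≡ true
    unselected∈C Py = unselected⊆C _ (cong not Py)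
    corner∈C : ∀ {u v} → P u ≡ false → P v ≡ false → C (proj₁ u , proj₂ v) ≡ true
    corner∈C {u} {v} Pu Pv =
      geodesic⊆convex _ C-convex (unselected∈C Pu) (unselected∈C Pv) (manhattan-corner u v)

  off-side : Side → Position
  off-side s x = not (does (onSide? s x))

  off-side-true⇒ : ∀ s x → off-side s x ≡ true → ¬ OnSide s x
  off-side-true⇒ s x off with onSide? s x
  ... | no x-off = x-off

  off-side-false⇒ : ∀ s x → off-side s x ≡ false → OnSide s x
  off-side-false⇒ s x on with onSide? s x
  ... | yes x-on = x-on

  off-side-intro : ∀ s x → ¬ OnSide s x → off-side s x ≡ true
  off-side-intro s x x-off with onSide? s x
  ... | yes x-on = contradiction x-on x-off
  ... | no _     = refl

  off-side-convex : ∀ s → Convex (Grid m n) (off-side s)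
  off-side-convex s = detours-longer⇒convex λ u v w u-off v-off w-on →
    side-detour s (off-side-false⇒ s w w-on) (off-side-true⇒ s u u-off) (off-side-true⇒ s v v-off)

  free? : ∀ P s → Dec (Free P s)
  free? P s = map′ (λ { (i , j , h) → (i , j) , h }) (λ { ((i , j) , h) → i , j , h })
                   (any? λ i → any? λ j → (P (i , j) Bool.≟ false) ×-dec onSide? s (i , j))

  legal⇒free : ∀ {P} s → Legal P → Free P s
  legal⇒free {P} s P-legal with free? P s | side-vertex s
  ... | yes free | _ = free
  ... | no ¬free | w , w-on =
    contradiction w-on
      (off-side-true⇒ s w (P-legal (off-side s) (off-side-convex s) unselected-off-side w))
    where
    unselected-off-side : ∀ x → not (P x) ≡ true → off-side s x ≡ true
    unselected-off-side x not-Px = off-side-intro s x λ x-on →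
      ¬free (x , trans (sym (not-involutive (P x))) (cong not not-Px) , x-on)

  legal? : ∀ P → Dec (Legal P)
  legal? P = map′ free⇒legal (λ P-legal s → legal⇒free s P-legal) all-free?
    where
    all-free? : Dec (∀ s → Free P s)
    all-free? = map′ (λ { (t , b , l , r) → λ { top → t ; bottom → b ; left → l ; right → r } })
                     (λ free → free top , free bottom , free left , free right)
                     (free? P top ×-dec free? P bottom ×-dec free? P left ×-dec free? P right)

  move? : ∀ P v → Dec (Move P v)
  move? P v = (P v Bool.≟ false) ×-dec legal? (insert v P)

  vertices : List Vertex
  vertices = cartesianProduct (allFin m) (allFin n)

  ∈-vertices : ∀ v → v ∈ vertices
  ∈-vertices (i , j) = ∈-cartesianProduct⁺ (∈-allFin i) (∈-allFin j)

  open Finite vertices ∈-vertices (cartesianProduct⁺ (allFin⁺ m) (allFin⁺ n))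
  open Symmetry reflect reflect-involutive

  mirror-free : ∀ {P v} s → Symmetric P → Free (insert v P) s → Free (insert v P) (opposite-side s) →
                Free (insert (reflect v) (insert v P)) s
  mirror-free {P} {v} s P-sym (x , x-free , x-on) (y , y-free , y-on) with gridEq x (reflect v)
  ... | no x≢σv  = x , trans (insert-≢ _ x≢σv) x-free , x-on
  ... | yes refl = reflect y , σy-free , reflect-side⁻¹ s y-on
    where
    open ≡-Reasoning
    y≢v : y ≢ v
    y≢v y≡v = contradiction (trans (sym (insert-≡ v P)) (subst (λ z → insert v P z ≡ false) y≡v y-free))
                            λ ()
    σy≢v : reflect y ≢ v
    σy≢v σy≡v = sides-disjoint s (subst (OnSide s) σy≡v (reflect-side⁻¹ s y-on))
                  (subst (OnSide (opposite-side s)) (reflect-involutive v) (reflect-side s x-on))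
    σy-free : insert (reflect v) (insert v P) (reflect y) ≡ false
    σy-free = begin
      insert (reflect v) (insert v P) (reflect y) ≡⟨ insert-≢ _ (y≢v ∘ σ-injective) ⟩
      insert v P (reflect y)                      ≡⟨ insert-≢ P σy≢v ⟩
      P (reflect y)                               ≡⟨ P-sym y ⟩
      P y                                         ≡⟨ insert-≢ P y≢v ⟨
      insert v P y                                ≡⟨ y-free ⟩
      false                                       ∎

  mirror-move : ∀ {P v} → Symmetric P → Move P v → reflect v ≢ v → Move (insert v P) (reflect v)
  mirror-move {P} {v} P-sym (Pv≡false , P+v-legal) σv≢v =
    trans (insert-≢ P σv≢v) (trans (P-sym v) Pv≡false) ,
    free⇒legal λ s →
      mirror-free s P-sym (legal⇒free s P+v-legal) (legal⇒free (opposite-side s) P+v-legal)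

  fixed-point-off-sides : ∀ {c} → reflect c ≡ c → ∀ s → ¬ OnSide s c
  fixed-point-off-sides σc≡c s c-on =
    sides-disjoint s c-on (subst (OnSide (opposite-side s)) σc≡c (reflect-side s c-on))

  fixed-point-move : ∀ {P c} → reflect c ≡ c → Legal P → P c ≡ false → Move P c
  fixed-point-move {P} {c} σc≡c P-legal Pc≡false =
    Pc≡false , free⇒legal λ s → still-free s (legal⇒free s P-legal)
    where
    still-free : ∀ s → Free P s → Free (insert c P) s
    still-free s (x , x-free , x-on) =
      x , trans (insert-≢ P λ x≡c → fixed-point-off-sides σc≡c s (subst (OnSide s) x≡c x-on)) x-free , x-on

  even⇒no-fixed-point : m % 2 ≡ 0 ⊎ n % 2 ≡ 0 → ∀ (x : Vertex) → reflect x ≢ x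
  even⇒no-fixed-point (inj₁ m-even) (i , _) fixed = even⇒no-opposite-fixed m-even i (cong proj₁ fixed)
  even⇒no-fixed-point (inj₂ n-even) (_ , j) fixed = even⇒no-opposite-fixed n-even j (cong proj₂ fixed)

  odd⇒unique-fixed-point : m % 2 ≡ 1 → n % 2 ≡ 1 →
                           ∃ λ (c : Vertex) → reflect c ≡ c × ∀ x → reflect x ≡ x → x ≡ c
  odd⇒unique-fixed-point m-odd n-odd with odd⇒opposite-fixed m-odd | odd⇒opposite-fixed n-odd
  ... | i , i-fixed | j , j-fixed =
    (i , j) , cong₂ _,_ i-fixed j-fixed ,
    λ x x-fixed → cong₂ _,_ (opposite-fixed-unique (cong proj₁ x-fixed) i-fixed)
                            (opposite-fixed-unique (cong proj₂ x-fixed) j-fixed)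

  empty-legal : Legal empty
  empty-legal = free⇒legal λ s → proj₁ (side-vertex s) , refl , proj₂ (side-vertex s)

  grundy-exists : ∃ IsGrundy
  grundy-exists = grundy move? , grundy-isGrundy move?

  module _ {f : Position → ℕ} (f-isGrundy : IsGrundy f) where

    open Strategy unselected (≤-reflexive ∘ move-decreases) mirror-move f-isGrundy

    even⇒value-zero : m % 2 ≡ 0 ⊎ n % 2 ≡ 0 → f empty ≡ 0
    even⇒value-zero even = fixed-selected⇒value-zero empty (⊏-wellFounded empty) empty-legal (λ _ → refl)
                             (λ x fixed → contradiction fixed (even⇒no-fixed-point even x))

    odd⇒value-one : m % 2 ≡ 1 → n % 2 ≡ 1 → f empty ≡ 1
    odd⇒value-one m-odd n-odd with odd⇒unique-fixed-point m-odd n-odd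
    ... | c , σc≡c , fixed⇒c = Centre.centre-unselected⇒value-one c σc≡c fixed⇒c (fixed-point-move σc≡c)
                                 empty (⊏-wellFounded empty) empty-legal (λ _ → refl) refl

    empty-value : f empty ≡ (m % 2) * (n % 2)
    empty-value with %2≡0⊎%2≡1 m | %2≡0⊎%2≡1 n
    ... | inj₁ m-even | _           rewrite m-even         = even⇒value-zero (inj₁ m-even)
    ... | inj₂ m-odd  | inj₁ n-even rewrite m-odd | n-even = even⇒value-zero (inj₂ n-even)
    ... | inj₂ m-odd  | inj₂ n-odd  rewrite m-odd | n-odd  = odd⇒value-one m-odd n-odd

mainTheorem1 : (m n : ℕ) → 2 ≤ m → m ≤ n → 3 ≤ n →
    DNT.NimValue (Grid m n) gridEq ((m * n) % 2)
mainTheorem1 m n 2≤m _ 3≤n =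
  grundy-exists , λ f f-isGrundy → trans (empty-value f-isGrundy) (sym ([m*n]%2≡[m%2]*[n%2] m n))
  where open GridGame m n 2≤m (≤-trans (n≤1+n 2) 3≤n)
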